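{- Let $n$ be a positive integer and suppose that $X$ squares, with $0<X\le n^2$, are marked in an $n\times n$ grid, and in each marked square is written either the number of marked squares in the same row or the number of marked squares in the same column (the choice may vary from square to square). Then the sum of the written numbers is at least $\frac{X^2}{2n-\frac{X}{n}}$. -}

module Defs where

open import Data.Nat using (ℕ; zero; suc; _+_; _*_)
open import Data.Bool using (Bool; true; false; if_then_else_)
open import Data.Fin using (Fin)
open import Data.Vec.Functional using (Vector; foldr)

sumFin : ∀ {n} → (Fin n → ℕ) → ℕ
sumFin {n} f = foldr _+_ 0 f

[_] : Bool → ℕ
[ b ] = if b then 1 else 0

-- A marking of the n×n grid: marked i j = true iff square (row i, column j) is marked.
Marking : ℕ → Set
Marking n = Fin n → Fin n → Bool

numMarked : ∀ {n} → Marking n → ℕ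
numMarked M = sumFin (λ i → sumFin (λ j → [ M i j ]))

rowCount : ∀ {n} → Marking n → Fin n → ℕ
rowCount M i = sumFin (λ j → [ M i j ])

colCount : ∀ {n} → Marking n → Fin n → ℕ
colCount M j = sumFin (λ i → [ M i j ])

-- Choice: useRow i j = true means the number written in (i,j) is the row count,
-- false means the column count.  (Only relevant for marked squares.)
written : ∀ {n} → Marking n → (Fin n → Fin n → Bool) → Fin n → Fin n → ℕ
written M useRow i j = if useRow i j then rowCount M i else colCount M j

writtenSum : ∀ {n} → Marking n → (Fin n → Fin n → Bool) → ℕ
writtenSum M useRow =
  sumFin (λ i → sumFin (λ j → if M i j then written M useRow i j else 0))

-- Give each marked square (i, j) the weight u = 1/rᵢ + 1/cⱼ − 1/n, where rᵢ and cⱼ are the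
-- numbers of marked squares in its row and column. Whichever of rᵢ, cⱼ is written there, the
-- written number w satisfies w·u ≥ 1 (as 1/cⱼ, 1/rᵢ ≥ 1/n), so Cauchy–Schwarz gives
-- X² ≤ S · Σ u. Summing the 1/rᵢ row by row and the 1/cⱼ column by column gives
-- Σ u ≤ n + n − X/n. All fractions are scaled by n! to stay in ℕ.
module Submission where

open import Defs
open import Data.Nat using (ℕ; zero; suc; _+_; _*_; _∸_; _≤_; _<_; z≤n; _!; NonZero)
open import Data.Fin using (Fin; zero; suc)
open import Data.Bool using (Bool; true; false; if_then_else_)
open import Data.Nat.Properties
open import Data.Nat.DivMod using (_/_; m*[n/m]≡n; m/n*n≤m; /-monoʳ-≤)
open import Data.Nat.Divisibility using (_∣_; ∣-trans; m∣m*n; m≤n⇒m!∣n!)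
open import Data.Nat.Tactic.RingSolver using (solve-∀)
open import Data.Vec.Functional using (Vector)
open import Data.Product using (_,_)
open import Data.Sum using ([_,_]′)
open import Relation.Nullary using (yes; no; contradiction)
open import Relation.Binary.PropositionalEquality hiding ([_])
open import Algebra.Properties.Semiring.Sum +-*-semiring
  using (sum; sum-cong-≗; ∑-distrib-+; ∑-comm; *-distribˡ-sum; *-distribʳ-sum)

sum-mono-≤ : ∀ {k} {f g : Vector ℕ k} → (∀ i → f i ≤ g i) → sum f ≤ sum g
sum-mono-≤ {zero} f≤g = z≤n
sum-mono-≤ {suc k} f≤g = +-mono-≤ (f≤g zero) (sum-mono-≤ (λ i → f≤g (suc i)))

sum-≤-* : ∀ {k} {f : Vector ℕ k} {c} → (∀ i → f i ≤ c) → sum f ≤ k * c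
sum-≤-* {zero} f≤c = z≤n
sum-≤-* {suc k} f≤c = +-mono-≤ (f≤c zero) (sum-≤-* (λ i → f≤c (suc i)))

≤-sum : ∀ {k} (f : Vector ℕ k) i → f i ≤ sum f
≤-sum f zero = m≤m+n _ _
≤-sum f (suc i) = ≤-trans (≤-sum (λ j → f (suc j)) i) (m≤n+m _ _)

4*m*n≤[m+n]² : ∀ m n → 4 * (m * n) ≤ (m + n) * (m + n)
4*m*n≤[m+n]² m n = [ ordered , swapped ]′ (≤-total m n)
  where
  ordered : ∀ {p q} → p ≤ q → 4 * (p * q) ≤ (p + q) * (p + q)
  ordered {p} p≤q with d , refl ← m≤n⇒∃[o]m+o≡n p≤q =
    ≤-trans (m≤m+n _ (d * d)) (≤-reflexive (square-of-sum p d))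
    where
    square-of-sum : ∀ p d → 4 * (p * (p + d)) + d * d ≡ (p + (p + d)) * (p + (p + d))
    square-of-sum = solve-∀
  swapped : n ≤ m → 4 * (m * n) ≤ (m + n) * (m + n)
  swapped n≤m =
    subst₂ _≤_ (cong (4 *_) (*-comm n m)) (cong (λ s → s * s) (+-comm n m)) (ordered n≤m)

m*m≤n*n⇒m≤n : ∀ {m n} → m * m ≤ n * n → m ≤ n
m*m≤n*n⇒m≤n {m} {n} m²≤n² with m ≤? n
... | yes m≤n = m≤n
... | no m≰n = contradiction m²≤n² (<⇒≱ (*-mono-< n<m n<m))
  where n<m = ≰⇒> m≰n

cross-term-bound : ∀ N a b w u {c m} → N * (c * c) ≤ a * b → N * (m * m) ≤ w * u →
                   2 * N * c * m ≤ a * u + w * b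
cross-term-bound N a b w u {c} {m} c²≤ab m²≤wu = m*m≤n*n⇒m≤n (begin
  (2 * N * c * m) * (2 * N * c * m)    ≡⟨ expand N c m ⟩
  4 * ((N * (c * c)) * (N * (m * m)))  ≤⟨ *-monoʳ-≤ 4 (*-mono-≤ c²≤ab m²≤wu) ⟩
  4 * ((a * b) * (w * u))              ≡⟨ cong (4 *_) (rearrange a b w u) ⟩
  4 * ((a * u) * (w * b))              ≤⟨ 4*m*n≤[m+n]² (a * u) (w * b) ⟩
  (a * u + w * b) * (a * u + w * b)    ∎)
  where
  open ≤-Reasoning
  expand : ∀ N c m → (2 * N * c * m) * (2 * N * c * m) ≡ 4 * ((N * (c * c)) * (N * (m * m)))
  expand = solve-∀
  rearrange : ∀ a b w u → (a * b) * (w * u) ≡ (a * u) * (w * b)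
  rearrange = solve-∀

sum-cross-term-bound : ∀ N a b {c k} {m : Vector ℕ k} (w u : Vector ℕ k) → N * (c * c) ≤ a * b →
                       (∀ i → N * (m i * m i) ≤ w i * u i) →
                       2 * N * c * sum m ≤ a * sum u + sum w * b
sum-cross-term-bound N a b {c} {m = m} w u c²≤ab m²≤wu = begin
  2 * N * c * sum m                      ≡⟨ *-distribˡ-sum (2 * N * c) m ⟩
  sum (λ i → 2 * N * c * m i)
    ≤⟨ sum-mono-≤ (λ i → cross-term-bound N a b (w i) (u i) c²≤ab (m²≤wu i)) ⟩
  sum (λ i → a * u i + w i * b)          ≡⟨ ∑-distrib-+ (λ i → a * u i) (λ i → w i * b) ⟩
  sum (λ i → a * u i) + sum (λ i → w i * b)
    ≡⟨ cong₂ _+_ (*-distribˡ-sum a u) (*-distribʳ-sum b w) ⟨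
  a * sum u + sum w * b                  ∎
  where open ≤-Reasoning

cauchy-schwarz : ∀ N {k} {m : Vector ℕ k} (w u : Vector ℕ k) → (∀ i → N * (m i * m i) ≤ w i * u i) →
                 N * (sum m * sum m) ≤ sum w * sum u
cauchy-schwarz N {zero} _ _ _ = ≤-reflexive (*-zeroʳ N)
cauchy-schwarz N {suc k} {m} w u m²≤wu = begin
  N * ((m₀ + M) * (m₀ + M))                               ≡⟨ expand N m₀ M ⟩
  N * (m₀ * m₀) + 2 * N * m₀ * M + N * (M * M)
    ≤⟨ +-mono-≤ (+-mono-≤ (m²≤wu zero) (sum-cross-term-bound N w₀ u₀ w′ u′ (m²≤wu zero) m′²≤w′u′))
                (cauchy-schwarz N w′ u′ m′²≤w′u′) ⟩
  w₀ * u₀ + (w₀ * U + W * u₀) + W * U                     ≡⟨ collect w₀ u₀ W U ⟩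
  (w₀ + W) * (u₀ + U)                                     ∎
  where
  open ≤-Reasoning
  m₀ = m zero
  w₀ = w zero
  u₀ = u zero
  w′ = λ i → w (suc i)
  u′ = λ i → u (suc i)
  m′²≤w′u′ = λ i → m²≤wu (suc i)
  M = sum (λ i → m (suc i))
  W = sum w′
  U = sum u′
  expand : ∀ N a M → N * ((a + M) * (a + M)) ≡ N * (a * a) + 2 * N * a * M + N * (M * M)
  expand = solve-∀
  collect : ∀ a b W U → a * b + (a * U + W * b) + W * U ≡ (a + W) * (b + U)
  collect = solve-∀

scaledInverse : ℕ → ℕ → ℕ
scaledInverse n zero = 0
scaledInverse n r@(suc _) = n ! / r

∣n! : ∀ {r n} → 1 ≤ r → r ≤ n → r ∣ n !
∣n! {suc k} _ r≤n = ∣-trans (m∣m*n (k !)) (m≤n⇒m!∣n! r≤n)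

*-scaledInverse≡n! : ∀ {n r} → 1 ≤ r → r ≤ n → r * scaledInverse n r ≡ n !
*-scaledInverse≡n! {r = suc _} 1≤r r≤n = m*[n/m]≡n (∣n! 1≤r r≤n)

*-scaledInverse≤n! : ∀ n r → r * scaledInverse n r ≤ n !
*-scaledInverse≤n! n zero = z≤n
*-scaledInverse≤n! n r@(suc _) = ≤-trans (≤-reflexive (*-comm r (n ! / r))) (m/n*n≤m (n !) r)

scaledInverse-antitone : ∀ n {r s} → 1 ≤ r → r ≤ s → scaledInverse n s ≤ scaledInverse n r
scaledInverse-antitone n {suc _} {suc _} _ r≤s = /-monoʳ-≤ (n !) r≤s

n!≤*-cellWeight : ∀ {n r c} b → 1 ≤ r → r ≤ n → 1 ≤ c → c ≤ n →
                  n ! ≤ (if b then r else c) *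
                        (scaledInverse n r + scaledInverse n c ∸ scaledInverse n n)
n!≤*-cellWeight {n} {r} {c} true 1≤r r≤n 1≤c c≤n = begin
  n !                      ≡⟨ *-scaledInverse≡n! 1≤r r≤n ⟨
  r * 1/r                  ≤⟨ *-monoʳ-≤ r (m≤m+n 1/r (1/c ∸ 1/n)) ⟩
  r * (1/r + (1/c ∸ 1/n))  ≡⟨ cong (r *_) (+-∸-assoc 1/r (scaledInverse-antitone n 1≤c c≤n)) ⟨
  r * (1/r + 1/c ∸ 1/n)    ∎
  where
  open ≤-Reasoning
  1/r = scaledInverse n r
  1/c = scaledInverse n c
  1/n = scaledInverse n n
n!≤*-cellWeight {n} {r} {c} false 1≤r r≤n 1≤c c≤n =
  subst (λ s → n ! ≤ c * (s ∸ scaledInverse n n))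
        (+-comm (scaledInverse n c) (scaledInverse n r))
        (n!≤*-cellWeight true 1≤c c≤n 1≤r r≤n)

sum-indicator≤length : ∀ {k} (f : Vector Bool k) → sum (λ j → [ f j ]) ≤ k
sum-indicator≤length f = ≤-trans (sum-≤-* (λ j → indicator≤1 (f j))) (≤-reflexive (*-identityʳ _))
  where
  indicator≤1 : ∀ b → [ b ] ≤ 1
  indicator≤1 true = ≤-refl
  indicator≤1 false = z≤n

sum-indicator-pos : ∀ {k} (f : Vector Bool k) {j} → f j ≡ true → 1 ≤ sum (λ j → [ f j ])
sum-indicator-pos f {j} fj≡true =
  subst (λ b → [ b ] ≤ sum (λ j → [ f j ])) fj≡true (≤-sum (λ j → [ f j ]) j)

ΣΣ : ∀ {a b} → (Fin a → Fin b → ℕ) → ℕ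
ΣΣ f = sum (λ i → sum (f i))

ΣΣ-distrib-+ : ∀ {a b} (f g : Fin a → Fin b → ℕ) → ΣΣ (λ i j → f i j + g i j) ≡ ΣΣ f + ΣΣ g
ΣΣ-distrib-+ f g =
  trans (sum-cong-≗ (λ i → ∑-distrib-+ (f i) (g i))) (∑-distrib-+ (λ i → sum (f i)) (λ i → sum (g i)))

ΣΣ-*ʳ : ∀ {a b} (f : Fin a → Fin b → ℕ) x → ΣΣ f * x ≡ ΣΣ (λ i j → f i j * x)
ΣΣ-*ʳ f x = trans (*-distribʳ-sum x (λ i → sum (f i))) (sum-cong-≗ (λ i → *-distribʳ-sum x (f i)))

module Grid {n} (M : Marking n) (useRow : Fin n → Fin n → Bool) where

  1/_ : ℕ → ℕ
  1/_ = scaledInverse n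

  r : Fin n → ℕ
  r = rowCount M

  c : Fin n → ℕ
  c = colCount M

  1≤r : ∀ {i j} → M i j ≡ true → 1 ≤ r i
  1≤r {i} = sum-indicator-pos (M i)

  r≤n : ∀ i → r i ≤ n
  r≤n i = sum-indicator≤length (M i)

  1≤c : ∀ {i j} → M i j ≡ true → 1 ≤ c j
  1≤c {j = j} = sum-indicator-pos (λ i → M i j)

  c≤n : ∀ j → c j ≤ n
  c≤n j = sum-indicator≤length (λ i → M i j)

  marked value weight rowShare colShare : Fin n → Fin n → ℕ
  marked i j = [ M i j ]
  value i j = if M i j then written M useRow i j else 0
  weight i j = if M i j then 1/ r i + 1/ c j ∸ 1/ n else 0
  rowShare i j = marked i j * 1/ r i
  colShare i j = marked i j * 1/ c j

  n!≤value*weight : ∀ i j → n ! * (marked i j * marked i j) ≤ value i j * weight i j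
  n!≤value*weight i j with M i j in Mij
  ... | false = ≤-reflexive (*-zeroʳ (n !))
  ... | true = ≤-trans (≤-reflexive (*-identityʳ (n !)))
      (n!≤*-cellWeight (useRow i j) (1≤r Mij) (r≤n i) (1≤c Mij) (c≤n j))

  weight+marked*1/n : ∀ i j → weight i j + marked i j * 1/ n ≡ rowShare i j + colShare i j
  weight+marked*1/n i j with M i j in Mij
  ... | false = refl
  ... | true = begin
    1/ r i + 1/ c j ∸ 1/ n + 1 * 1/ n     ≡⟨ cong (1/ r i + 1/ c j ∸ 1/ n +_) (*-identityˡ (1/ n)) ⟩
    1/ r i + 1/ c j ∸ 1/ n + 1/ n         ≡⟨ m∸n+n≡m (≤-trans 1/n≤1/c (m≤n+m _ _)) ⟩
    1/ r i + 1/ c j                       ≡⟨ cong₂ _+_ (*-identityˡ (1/ r i)) (*-identityˡ (1/ c j)) ⟨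
    1 * 1/ r i + 1 * 1/ c j               ∎
    where
    open ≡-Reasoning
    1/n≤1/c = scaledInverse-antitone n (1≤c Mij) (c≤n j)

  row-shares : ΣΣ rowShare ≤ n * n !
  row-shares = begin
    sum (λ i → sum (λ j → marked i j * 1/ r i))  ≡⟨ sum-cong-≗ (λ i → *-distribʳ-sum (1/ r i) (marked i)) ⟨
    sum (λ i → r i * 1/ r i)                     ≤⟨ sum-≤-* (λ i → *-scaledInverse≤n! n (r i)) ⟩
    n * n !                                      ∎
    where open ≤-Reasoning

  col-shares : ΣΣ colShare ≤ n * n !
  col-shares = begin
    sum (λ i → sum (λ j → marked i j * 1/ c j))  ≡⟨ ∑-comm colShare ⟩
    sum (λ j → sum (λ i → marked i j * 1/ c j))  ≡⟨ sum-cong-≗ (λ j → *-distribʳ-sum (1/ c j) (λ i → marked i j)) ⟨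
    sum (λ j → c j * 1/ c j)                     ≤⟨ sum-≤-* (λ j → *-scaledInverse≤n! n (c j)) ⟩
    n * n !                                      ∎
    where open ≤-Reasoning

  weight-total+marked*1/n : ΣΣ weight + numMarked M * 1/ n ≤ n * n ! + n * n !
  weight-total+marked*1/n = begin
    ΣΣ weight + ΣΣ marked * 1/ n                 ≡⟨ cong (ΣΣ weight +_) (ΣΣ-*ʳ marked (1/ n)) ⟩
    ΣΣ weight + ΣΣ (λ i j → marked i j * 1/ n)   ≡⟨ ΣΣ-distrib-+ weight _ ⟨
    ΣΣ (λ i j → weight i j + marked i j * 1/ n)  ≡⟨ sum-cong-≗ (λ i → sum-cong-≗ (weight+marked*1/n i)) ⟩
    ΣΣ (λ i j → rowShare i j + colShare i j)     ≡⟨ ΣΣ-distrib-+ rowShare colShare ⟩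
    ΣΣ rowShare + ΣΣ colShare                    ≤⟨ +-mono-≤ row-shares col-shares ⟩
    n * n ! + n * n !                            ∎
    where open ≤-Reasoning

  weight-total≤ : 1 ≤ n → ΣΣ weight ≤ (2 * n * n ∸ numMarked M) * 1/ n
  weight-total≤ 1≤n = begin
    ΣΣ weight                              ≡⟨ m+n∸n≡m (ΣΣ weight) (X * 1/ n) ⟨
    ΣΣ weight + X * 1/ n ∸ X * 1/ n        ≤⟨ ∸-monoˡ-≤ (X * 1/ n) weight-total+marked*1/n ⟩
    n * n ! + n * n ! ∸ X * 1/ n
      ≡⟨ cong (λ m → n * m + n * m ∸ X * 1/ n) (*-scaledInverse≡n! 1≤n ≤-refl) ⟨
    n * (n * 1/ n) + n * (n * 1/ n) ∸ X * 1/ n  ≡⟨ cong (_∸ X * 1/ n) (double n (1/ n)) ⟩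
    2 * n * n * 1/ n ∸ X * 1/ n            ≡⟨ *-distribʳ-∸ (1/ n) (2 * n * n) X ⟨
    (2 * n * n ∸ X) * 1/ n                 ∎
    where
    open ≤-Reasoning
    X = numMarked M
    double : ∀ n s → n * (n * s) + n * (n * s) ≡ 2 * n * n * s
    double = solve-∀

  n!*X²≤writtenSum*weight-total :
    n ! * (numMarked M * numMarked M) ≤ writtenSum M useRow * ΣΣ weight
  n!*X²≤writtenSum*weight-total =
    cauchy-schwarz (n !) (λ i → sum (value i)) (λ i → sum (weight i))
      (λ i → cauchy-schwarz (n !) (value i) (weight i) (n!≤value*weight i))

lemma17 : (n : ℕ) → 0 < n → (M : Marking n) → (useRow : Fin n → Fin n → Bool) →
    0 < numMarked M → numMarked M ≤ n * n →
    numMarked M * numMarked M * n ≤ writtenSum M useRow * (2 * n * n ∸ numMarked M)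
lemma17 n 1≤n M useRow _ _ = *-cancelˡ-≤ 1/n {{1/n≢0}} (begin
  1/n * (X * X * n)              ≡⟨ rearrange 1/n X n ⟩
  (n * 1/n) * (X * X)            ≡⟨ cong (_* (X * X)) n*1/n≡n! ⟩
  n ! * (X * X)                  ≤⟨ Grid.n!*X²≤writtenSum*weight-total M useRow ⟩
  S * ΣΣ (Grid.weight M useRow)  ≤⟨ *-monoʳ-≤ S (Grid.weight-total≤ M useRow 1≤n) ⟩
  S * ((2 * n * n ∸ X) * 1/n)    ≡⟨ rotate S (2 * n * n ∸ X) 1/n ⟩
  1/n * (S * (2 * n * n ∸ X))    ∎)
  where
  open ≤-Reasoning
  X = numMarked M
  S = writtenSum M useRow
  1/n = scaledInverse n n
  n*1/n≡n! : n * 1/n ≡ n !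
  n*1/n≡n! = *-scaledInverse≡n! 1≤n ≤-refl
  1/n≢0 : NonZero 1/n
  1/n≢0 = m*n≢0⇒n≢0 n {{subst NonZero (sym n*1/n≡n!) (n !≢0)}}
  rearrange : ∀ s x n → s * (x * x * n) ≡ (n * s) * (x * x)
  rearrange = solve-∀
  rotate : ∀ s d k → s * (d * k) ≡ k * (s * d)
  rotate = solve-∀
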